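{- There exist infinitely many even integers $n\ge 4$ for which the Goldbach factorization graph $F_n$ contains a trivial autonomous component.
   Context: For an even integer $n\ge 4$, the Goldbach factorization graph is the directed weighted graph $F_n=(V_n,A_n,w_n)$ with vertex set $V_n=[2,n-2]\cap\mathbb{P}$ ($\mathbb{P}$ the set of primes), arc set $A_n=\{(s,t)\in V_n^2 : s \mid (n-t)\}$ (loops allowed), and weights $w_n((s,t))=\max\{e\ge 1: s^e\mid (n-t)\}$. An autonomous component of $F_n$ is a minimal (with respect to inclusion) nonempty subgraph of $F_n$ induced by a vertex set $U\subseteq V_n$ such that $(s,t)\notin A_n$ for every $s\in V_n\setminus U$ and $t\in U$. A Goldbach autonomous component (GAC) is an autonomous component induced by vertices $v_1,v_2\in V_n$ with $v_1+v_2=n$ (a single vertex if $v_1=v_2$). A trivial autonomous component (TAC) is an autonomous component induced by a single vertex that is not a GAC. -}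

module Defs where

open import Level using (0ℓ)
open import Data.Nat using (ℕ; _+_; _∸_; _≤_)
open import Data.Nat.Divisibility using (_∣_)
open import Data.Nat.Primality using (Prime)
open import Data.Product using (Σ; ∃; _×_)
open import Data.Sum using (_⊎_)
open import Relation.Nullary using (¬_)
open import Relation.Unary using (Pred; _⊆_; Satisfiable)
open import Relation.Binary.PropositionalEquality using (_≡_)
open import Function.Bundles using (_⇔_)

Vertex : ℕ → Pred ℕ 0ℓ
Vertex n p = Prime p × 2 ≤ p × p ≤ n ∸ 2

-- Arc set A_n : (s,t) with s,t ∈ V_n and s ∣ (n - t)
-- (for t ∈ V_n we have t ≤ n - 2, so truncated subtraction is exact)
Arc : ℕ → ℕ → ℕ → Set
Arc n s t = Vertex n s × Vertex n t × s ∣ (n ∸ t)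

Closed : ℕ → Pred ℕ 0ℓ → Set
Closed n U = ∀ s t → Vertex n s → ¬ U s → U t → ¬ Arc n s t

IsAutonomous : ℕ → Pred ℕ 0ℓ → Set
IsAutonomous n U = (U ⊆ Vertex n) × Satisfiable U × Closed n U

-- Autonomous component: inclusion-minimal autonomous vertex set
-- (the induced subgraph is determined by its vertex set)
AutonomousComponent : ℕ → Pred ℕ 0ℓ → Set₁
AutonomousComponent n U =
  IsAutonomous n U ×
  (∀ (W : Pred ℕ 0ℓ) → W ⊆ U → IsAutonomous n W → U ⊆ W)

GAC : ℕ → Pred ℕ 0ℓ → Set₁
GAC n U = AutonomousComponent n U ×
  Σ ℕ (λ v₁ → Σ ℕ (λ v₂ → Vertex n v₁ × Vertex n v₂ × v₁ + v₂ ≡ n ×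
    (∀ x → U x ⇔ (x ≡ v₁ ⊎ x ≡ v₂))))

TAC : ℕ → Pred ℕ 0ℓ → Set₁
TAC n U = AutonomousComponent n U ×
  Σ ℕ (λ v → Vertex n v × (∀ x → U x ⇔ x ≡ v)) × ¬ GAC n U

HasTAC : ℕ → Set₁
HasTAC n = Σ (Pred ℕ 0ℓ) (λ U → TAC n U)

{-# OPTIONS --safe #-}
module Submission where

-- For n = 2 + 2ᵏ the only vertex dividing n − 2 = 2ᵏ is 2, so no arc enters 2
-- from another vertex and {2} is an autonomous component. It is not Goldbach
-- because 2 + 2 ≠ n once k ≥ 2.

open import Defs
open import Data.Nat using (ℕ; zero; suc; _+_; _^_; _≤_; _<_; z≤n; s≤s; nonTrivial⇒≢1)
open import Data.Nat.Properties
  using (≤-refl; ≤-trans; <⇒≤; <⇒≢; n≤1+n; m≤m+n; m≤n+m; +-mono-≤; +-monoʳ-<; m^n>0; ^-monoʳ-≤)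
open import Data.Nat.Divisibility using (_∣_; ∣-refl; ∣m∣n⇒∣m+n; ∣m⇒∣m*n; ∣1⇒≡1)
open import Data.Nat.Primality using (Prime; prime; prime[2]; euclidsLemma; prime⇒irreducible)
open import Data.Product using (Σ; _×_; _,_)
open import Data.Sum using (inj₁; inj₂)
open import Data.Empty using (⊥-elim)
open import Relation.Binary.PropositionalEquality using (_≡_; _≢_; refl; sym; trans; cong₂; subst)
open import Function.Bundles using (Equivalence; mk⇔)

n≤2^n : ∀ n → n ≤ 2 ^ n
n≤2^n zero    = z≤n
n≤2^n (suc n) = +-mono-≤ (m^n>0 2 n) (≤-trans (n≤2^n n) (m≤m+n (2 ^ n) 0))

prime∣prime^⇒≡ : ∀ k {p q} → Prime p → Prime q → q ∣ p ^ k → q ≡ p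
prime∣prime^⇒≡ zero    _  (prime _) q∣1 = ⊥-elim (nonTrivial⇒≢1 (∣1⇒≡1 q∣1))
prime∣prime^⇒≡ (suc k) pp pq@(prime _) q∣p^k+1 with euclidsLemma _ _ pq q∣p^k+1
... | inj₂ q∣p^k = prime∣prime^⇒≡ k pp pq q∣p^k
... | inj₁ q∣p with prime⇒irreducible pp q∣p
...   | inj₁ q≡1 = ⊥-elim (nonTrivial⇒≢1 q≡1)
...   | inj₂ q≡p = q≡p

module _ {n v : ℕ} (vertex : Vertex n v) where

  singleton-autonomousComponent : (∀ {s} → Arc n s v → s ≡ v) →
                                  AutonomousComponent n (_≡ v)
  singleton-autonomousComponent only-loop = (⊆vertex , (v , refl) , closed) , minimal
    where
    ⊆vertex : ∀ {x} → x ≡ v → Vertex n x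
    ⊆vertex refl = vertex

    closed : Closed n (_≡ v)
    closed s t _ s≢v refl arc = s≢v (only-loop arc)

    minimal : ∀ W → (∀ {x} → W x → x ≡ v) → IsAutonomous n W → ∀ {x} → x ≡ v → W x
    minimal W W⊆U (_ , (w , Ww) , _) refl = subst W (W⊆U Ww) Ww

  singleton-GAC⇒v+v≡n : GAC n (_≡ v) → v + v ≡ n
  singleton-GAC⇒v+v≡n (_ , v₁ , v₂ , _ , _ , v₁+v₂≡n , U⇔) =
    trans (sym (cong₂ _+_ (from v₁ (inj₁ refl)) (from v₂ (inj₂ refl)))) v₁+v₂≡n
    where from = λ x → Equivalence.from (U⇔ x)

  singleton-TAC : (∀ {s} → Arc n s v → s ≡ v) → v + v ≢ n → TAC n (_≡ v)
  singleton-TAC only-loop v+v≢n =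
    singleton-autonomousComponent only-loop ,
    (v , vertex , λ _ → mk⇔ (λ x≡v → x≡v) (λ x≡v → x≡v)) ,
    λ gac → v+v≢n (singleton-GAC⇒v+v≡n gac)

hasTAC[2+2^k] : ∀ {k} → 2 ≤ k → HasTAC (2 + 2 ^ k)
hasTAC[2+2^k] {k} 2≤k = (_≡ 2) , singleton-TAC vertex-2 only-loop 2+2≢n
  where
  2<2^k : 2 < 2 ^ k
  2<2^k = ≤-trans (n≤1+n 3) (^-monoʳ-≤ 2 2≤k)

  vertex-2 : Vertex (2 + 2 ^ k) 2
  vertex-2 = prime[2] , ≤-refl , <⇒≤ 2<2^k

  -- The arc condition s ∣ (2 + 2 ^ k) ∸ 2 reduces to s ∣ 2 ^ k.
  only-loop : ∀ {s} → Arc (2 + 2 ^ k) s 2 → s ≡ 2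
  only-loop ((ps , _) , _ , s∣2^k) = prime∣prime^⇒≡ k prime[2] ps s∣2^k

  2+2≢n : 2 + 2 ≢ 2 + 2 ^ k
  2+2≢n = <⇒≢ (+-monoʳ-< 2 2<2^k)

proposition1 : (m : ℕ) → Σ ℕ (λ n → m ≤ n × 2 ∣ n × 4 ≤ n × HasTAC n)
proposition1 m = 2 + 2 ^ k , m≤n , 2∣n , ≤-trans (^-monoʳ-≤ 2 2≤k) (m≤n+m _ 2) , hasTAC[2+2^k] 2≤k
  where
  k : ℕ
  k = 2 + m

  2≤k : 2 ≤ k
  2≤k = s≤s (s≤s z≤n)

  m≤n : m ≤ 2 + 2 ^ k
  m≤n = ≤-trans (m≤n+m m 2) (≤-trans (n≤2^n k) (m≤n+m _ 2))

  2∣n : 2 ∣ 2 + 2 ^ k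
  2∣n = ∣m∣n⇒∣m+n ∣-refl (∣m⇒∣m*n (2 ^ suc m) ∣-refl)
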